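{- Let $w=[w_1,\dots,w_n]\in\widetilde{C}_n/C_n$ with $w_i=c_iN+\sigma_i$, where $N=2n+2$, $c_i\in\mathbb{Z}$ and $\sigma\in C_n$. Then \[ \mathsf{inv}_{\widetilde{C}}(w)=\sum_{i=1}^n 2ic_i-\mathsf{inv}_C(\sigma). \]
   Context: $C_n$ is the set of signed permutations (integer sequences $\sigma$ with $(|\sigma_1|,\dots,|\sigma_n|)$ a permutation of $\{1,\dots,n\}$). $\widetilde{C}_n/C_n$ denotes the set of windows of minimal length coset representatives of the affine hyperoctahedral group modulo the hyperoctahedral group; concretely it is the set of integer tuples $[w_1,\dots,w_n]$ with $0<w_1<\cdots<w_n$ such that $\pm w_1,\dots,\pm w_n$ are pairwise distinct modulo $N$; each has a unique representation $w_i=c_iN+\sigma_i$ with $\sigma\in C_n$. $I_{i,j}(w)=\lfloor (w_i-w_j)/N\rfloor+\lfloor (w_i+w_j)/N\rfloor$ for $1\le j\le i\le n$, $I_i(w)=\sum_{j\le i}I_{i,j}(w)$, $\mathsf{inv}_{\widetilde{C}}(w)=\sum_iI_i(w)$. For $\sigma\in C_n$: $\mathsf{inv}(\sigma)=\#\{(j,i):j<i,\ \sigma_j>\sigma_i\}$, $\mathsf{nsp}(\sigma)=\#\{(j,i):j<i,\ \sigma_j+\sigma_i<0\}$, $\mathsf{neg}(\sigma)=\#\{i:\sigma_i<0\}$, and $\mathsf{inv}_C(\sigma)=\mathsf{inv}(\sigma)+\mathsf{neg}(\sigma)+\mathsf{nsp}(\sigma)$. -}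

module Defs where

open import Data.Nat as ℕ using (ℕ; suc)
open import Data.Integer as ℤ using (ℤ; +_; ∣_∣; -_; _<_; _>_)
import Data.Integer.Properties as ℤP
open import Data.Integer.DivMod using (_/ℕ_; _%ℕ_)
open import Data.Fin as Fin using (Fin; toℕ)
open import Data.List as List using (List; tabulate; allFin; filter; length; concatMap; upTo)
open import Data.List.Relation.Binary.Permutation.Propositional using (_↭_)
open import Data.Product using (_×_; _,_; proj₁; proj₂)
open import Relation.Binary.PropositionalEquality using (_≡_; _≢_)
open import Relation.Nullary.Decidable using (_×-dec_)
import Data.Fin.Properties as FinP

-- The modulus N = 2n+2 (as a natural number, written so that NonZero is automatic).
Nℕ : ℕ → ℕ
Nℕ n = suc (suc (2 ℕ.* n))

Σℤ : {n : ℕ} → (Fin n → ℤ) → ℤ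
Σℤ f = List.foldr ℤ._+_ (+ 0) (tabulate f)

IsSignedPerm : (n : ℕ) → (Fin n → ℤ) → Set
IsSignedPerm n σ = tabulate (λ i → ∣ σ i ∣) ↭ List.map suc (upTo n)

-- Windows of minimal length coset representatives of C̃_n / C_n:
-- 0 < w_1 < ... < w_n, and ±w_1,...,±w_n pairwise distinct modulo N.
IsAffineCosetWindow : (n : ℕ) → (Fin n → ℤ) → Set
IsAffineCosetWindow n w =
  (∀ i → + 0 < w i) ×
  (∀ (i j : Fin n) → toℕ i ℕ.< toℕ j → w i < w j) ×
  (∀ (i j : Fin n) → i ≢ j → (w i) %ℕ (Nℕ n) ≢ (w j) %ℕ (Nℕ n)) ×
  (∀ (i j : Fin n) → (w i) %ℕ (Nℕ n) ≢ (ℤ.- (w j)) %ℕ (Nℕ n))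
  -- the last clause for i ≡ j says w_i ≢ -w_i mod N

pairsLt : (n : ℕ) → List (Fin n × Fin n)
pairsLt n = filter (λ p → toℕ (proj₁ p) ℕ.<? toℕ (proj₂ p))
                   (concatMap (λ j → List.map (λ i → (j , i)) (allFin n)) (allFin n))

invC0 : {n : ℕ} → (Fin n → ℤ) → ℕ
invC0 {n} σ = length (filter (λ p → σ (proj₂ p) ℤ.<? σ (proj₁ p)) (pairsLt n))

nsp : {n : ℕ} → (Fin n → ℤ) → ℕ
nsp {n} σ = length (filter (λ p → σ (proj₁ p) ℤ.+ σ (proj₂ p) ℤ.<? + 0) (pairsLt n))

neg : {n : ℕ} → (Fin n → ℤ) → ℕ
neg {n} σ = length (filter (λ i → σ i ℤ.<? + 0) (allFin n))

invC : {n : ℕ} → (Fin n → ℤ) → ℕ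
invC σ = invC0 σ ℕ.+ neg σ ℕ.+ nsp σ

-- I_{i,j}(w) = ⌊(w_i - w_j)/N⌋ + ⌊(w_i + w_j)/N⌋   (floor division)
Iij : {n : ℕ} → (Fin n → ℤ) → Fin n → Fin n → ℤ
Iij {n} w i j = ((w i ℤ.- w j) /ℕ Nℕ n) ℤ.+ ((w i ℤ.+ w j) /ℕ Nℕ n)

Ii : {n : ℕ} → (Fin n → ℤ) → Fin n → ℤ
Ii {n} w i = List.foldr ℤ._+_ (+ 0)
  (List.map (Iij w i) (filter (λ j → toℕ j ℕ.≤? toℕ i) (allFin n)))

invAffC : {n : ℕ} → (Fin n → ℤ) → ℤ
invAffC w = Σℤ (Ii w)

-- Write w_i = c_i N + σ_i. Since |σ_i| ≤ n, both σ_i − σ_j and σ_i + σ_j lie strictly between −N and N,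
-- so each floor in I_{i,j} is the corresponding combination of the c's minus a borrow of 1 exactly when
-- that σ-combination is negative:  I_{i,j} = 2c_i − [σ_i < σ_j] − [σ_i + σ_j < 0].  Summing over j ≤ i
-- gives 2(i+1)c_i minus the borrows; the diagonal borrow is [2σ_i < 0] = [σ_i < 0], and summed over i
-- the off-diagonal borrows count the pairs j < i with σ_j > σ_i (inv) and with σ_j + σ_i < 0 (nsp),
-- while the diagonal ones count neg.

module Submission where

open import Defs
open import Data.Nat using (ℕ; suc)
open import Data.Integer using (ℤ; +_; _+_; _*_; _-_)
open import Data.Fin using (Fin; toℕ)
open import Relation.Binary.PropositionalEquality using (_≡_)

import Data.Nat as ℕ
import Data.Nat.Properties as ℕP
open import Data.Integer using (-[1+_]; -_; _<_; _≤_; _<?_; +<+; -<+; ∣_∣)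
open import Data.Integer using () renaming (suc to sucℤ)
import Data.Integer.Properties as ℤP
open import Data.Integer.DivMod using (_/ℕ_; [n/ℕd]*d≤n; n<s[n/ℕd]*d)
open import Data.Integer.Tactic.RingSolver using (solve-∀)
open import Algebra.Properties.Semiring.Sum ℤP.+-*-semiring
  using (sum-syntax; sum-cong-≗; ∑-distrib-+; ∑-comm; *-distribʳ-sum; sum-replicate-zero)
open import Data.Fin using (zero; suc)
open import Data.List using (List; []; _∷_; _++_; map; foldr; filter; length; concatMap; allFin)
import Data.List.Properties as ListP
open import Data.List.Membership.Propositional.Properties using (∈-tabulate⁺; ∈-map⁻; ∈-upTo⁻)
open import Data.List.Relation.Binary.Permutation.Propositional.Properties using (∈-resp-↭)
open import Data.Product using (_×_; _,_; proj₁; proj₂)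
open import Data.Bool using (if_then_else_; true; false)
open import Function using (_∘_; _⇔_; mk⇔)
open import Relation.Nullary using (Dec; does; ¬_)
open import Relation.Nullary.Decidable using (dec-false; does-⇔)
open import Relation.Unary using (Pred; Decidable)
open import Relation.Binary.PropositionalEquality using (refl; sym; trans; cong; cong₂; subst; subst₂; module ≡-Reasoning)

⟦_⟧ : ∀ {p} {P : Set p} → Dec P → ℤ
⟦ P? ⟧ = if does P? then + 1 else + 0

⟦⟧-⇔ : ∀ {p q} {P : Set p} {Q : Set q} → P ⇔ Q → (P? : Dec P) (Q? : Dec Q) → ⟦ P? ⟧ ≡ ⟦ Q? ⟧
⟦⟧-⇔ P⇔Q P? Q? = cong (λ b → if b then + 1 else + 0) (does-⇔ P⇔Q P? Q?)

⟦⟧-false : ∀ {p} {P : Set p} (P? : Dec P) → ¬ P → ⟦ P? ⟧ ≡ + 0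
⟦⟧-false P? ¬P = cong (λ b → if b then + 1 else + 0) (dec-false P? ¬P)

listSum : List ℤ → ℤ
listSum = foldr _+_ (+ 0)

listSum-++ : ∀ xs ys → listSum (xs ++ ys) ≡ listSum xs + listSum ys
listSum-++ []       ys = sym (ℤP.+-identityˡ _)
listSum-++ (x ∷ xs) ys = trans (cong (_+_ x) (listSum-++ xs ys)) (sym (ℤP.+-assoc x _ _))

listSum-map-filter : ∀ {a p} {A : Set a} {P : Pred A p} (P? : Decidable P) (f : A → ℤ) xs →
  listSum (map f (filter P? xs)) ≡ listSum (map (λ x → ⟦ P? x ⟧ * f x) xs)
listSum-map-filter P? f [] = refl
listSum-map-filter P? f (x ∷ xs) with does (P? x)
... | true  = cong₂ _+_ (sym (ℤP.*-identityˡ (f x))) (listSum-map-filter P? f xs)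
... | false = trans (listSum-map-filter P? f xs) (sym (ℤP.+-identityˡ _))

length≡listSum : ∀ {a} {A : Set a} (xs : List A) → + length xs ≡ listSum (map (λ _ → + 1) xs)
length≡listSum []       = refl
length≡listSum (x ∷ xs) = trans (ℤP.pos-+ 1 (length xs)) (cong (_+_ (+ 1)) (length≡listSum xs))

length-filter≡listSum : ∀ {a p} {A : Set a} {P : Pred A p} (P? : Decidable P) xs →
  + length (filter P? xs) ≡ listSum (map (λ x → ⟦ P? x ⟧) xs)
length-filter≡listSum P? xs = begin
  + length (filter P? xs)                       ≡⟨ length≡listSum (filter P? xs) ⟩
  listSum (map (λ _ → + 1) (filter P? xs))      ≡⟨ listSum-map-filter P? (λ _ → + 1) xs ⟩
  listSum (map (λ x → ⟦ P? x ⟧ * + 1) xs)       ≡⟨ cong listSum (ListP.map-cong (λ x → ℤP.*-identityʳ ⟦ P? x ⟧) xs) ⟩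
  listSum (map (λ x → ⟦ P? x ⟧) xs)             ∎
  where open ≡-Reasoning

listSum-concatMap : ∀ {a b} {A : Set a} {B : Set b} (g : B → ℤ) (h : A → List B) xs →
  listSum (map g (concatMap h xs)) ≡ listSum (map (λ x → listSum (map g (h x))) xs)
listSum-concatMap g h []       = refl
listSum-concatMap g h (x ∷ xs) = begin
  listSum (map g (h x ++ concatMap h xs))                    ≡⟨ cong listSum (ListP.map-++ g (h x) (concatMap h xs)) ⟩
  listSum (map g (h x) ++ map g (concatMap h xs))            ≡⟨ listSum-++ (map g (h x)) _ ⟩
  listSum (map g (h x)) + listSum (map g (concatMap h xs))   ≡⟨ cong (λ s → listSum (map g (h x)) + s) (listSum-concatMap g h xs) ⟩
  listSum (map g (h x)) + listSum (map (λ x → listSum (map g (h x))) xs) ∎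
  where open ≡-Reasoning

Σℤ≡∑ : ∀ {n} (f : Fin n → ℤ) → Σℤ f ≡ ∑[ i < n ] f i
Σℤ≡∑ {ℕ.zero}  f = refl
Σℤ≡∑ {suc n}   f = cong (_+_ (f zero)) (Σℤ≡∑ (f ∘ suc))

listSum-allFin : ∀ {n} (f : Fin n → ℤ) → listSum (map f (allFin n)) ≡ ∑[ i < n ] f i
listSum-allFin f = trans (cong listSum (ListP.map-tabulate (λ i → i) f)) (Σℤ≡∑ f)

length-filter-pairsLt : ∀ {n q} {Q : Pred (Fin n × Fin n) q} (Q? : Decidable Q) →
  + length (filter Q? (pairsLt n)) ≡ ∑[ j < n ] ∑[ i < n ] (⟦ toℕ j ℕ.<? toℕ i ⟧ * ⟦ Q? (j , i) ⟧)
length-filter-pairsLt {n} Q? = begin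
  + length (filter Q? (filter lt? pairs))                        ≡⟨ length-filter≡listSum Q? (filter lt? pairs) ⟩
  listSum (map (⟦_⟧ ∘ Q?) (filter lt? pairs))                   ≡⟨ listSum-map-filter lt? (⟦_⟧ ∘ Q?) pairs ⟩
  listSum (map g pairs)                                         ≡⟨ listSum-concatMap g row (allFin n) ⟩
  listSum (map (λ j → listSum (map g (row j))) (allFin n))      ≡⟨ listSum-allFin (λ j → listSum (map g (row j))) ⟩
  ∑[ j < n ] listSum (map g (row j))                            ≡⟨ sum-cong-≗ (λ j → trans (cong listSum (sym (ListP.map-∘ (allFin n)))) (listSum-allFin (g ∘ (j ,_)))) ⟩
  ∑[ j < n ] ∑[ i < n ] (⟦ toℕ j ℕ.<? toℕ i ⟧ * ⟦ Q? (j , i) ⟧) ∎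
  where
  open ≡-Reasoning
  lt? : Decidable (λ (p : Fin n × Fin n) → toℕ (proj₁ p) ℕ.< toℕ (proj₂ p))
  lt? p = toℕ (proj₁ p) ℕ.<? toℕ (proj₂ p)
  row : Fin n → List (Fin n × Fin n)
  row j = map (j ,_) (allFin n)
  pairs : List (Fin n × Fin n)
  pairs = concatMap row (allFin n)
  g : Fin n × Fin n → ℤ
  g p = ⟦ lt? p ⟧ * ⟦ Q? p ⟧

⟦1+m≤1+n⟧≡⟦m≤n⟧ : ∀ m n → ⟦ suc m ℕ.≤? suc n ⟧ ≡ ⟦ m ℕ.≤? n ⟧
⟦1+m≤1+n⟧≡⟦m≤n⟧ m n = ⟦⟧-⇔ (mk⇔ ℕ.s≤s⁻¹ ℕ.s≤s) (suc m ℕ.≤? suc n) (m ℕ.≤? n)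

∑⟦≤i⟧*f≡∑⟦<i⟧*f+f[i] : ∀ {n} (f : Fin n → ℤ) (i : Fin n) →
  ∑[ j < n ] (⟦ toℕ j ℕ.≤? toℕ i ⟧ * f j) ≡ ∑[ j < n ] (⟦ toℕ j ℕ.<? toℕ i ⟧ * f j) + f i
-- For i = 0 every bracket with j > 0 computes to + 0, so both sides share the same tail sum.
∑⟦≤i⟧*f≡∑⟦<i⟧*f+f[i] f zero    = diagonal-first (f zero) (∑[ j < _ ] (+ 0 * f (suc j)))
  where
  diagonal-first : ∀ a z → + 1 * a + z ≡ (+ 0 * a + z) + a
  diagonal-first = solve-∀
∑⟦≤i⟧*f≡∑⟦<i⟧*f+f[i] f (suc i) = begin
  + 1 * f zero + ∑[ j < _ ] (⟦ suc (toℕ j) ℕ.≤? suc (toℕ i) ⟧ * f (suc j))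
    ≡⟨ cong (λ s → + 1 * f zero + s) (sum-cong-≗ (λ j → cong (_* f (suc j)) (⟦1+m≤1+n⟧≡⟦m≤n⟧ (toℕ j) (toℕ i)))) ⟩
  + 1 * f zero + ∑[ j < _ ] (⟦ toℕ j ℕ.≤? toℕ i ⟧ * f (suc j))
    ≡⟨ cong (λ s → + 1 * f zero + s) (∑⟦≤i⟧*f≡∑⟦<i⟧*f+f[i] (f ∘ suc) i) ⟩
  + 1 * f zero + (∑[ j < _ ] (⟦ toℕ j ℕ.<? toℕ i ⟧ * f (suc j)) + f (suc i))
    ≡⟨ sym (ℤP.+-assoc (+ 1 * f zero) (∑[ j < _ ] (⟦ toℕ j ℕ.<? toℕ i ⟧ * f (suc j))) (f (suc i))) ⟩
  + 1 * f zero + ∑[ j < _ ] (⟦ toℕ j ℕ.<? toℕ i ⟧ * f (suc j)) + f (suc i)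
    ≡⟨ cong (λ s → + 1 * f zero + s + f (suc i))
         (sum-cong-≗ (λ j → cong (_* f (suc j)) (sym (⟦1+m≤1+n⟧≡⟦m≤n⟧ (suc (toℕ j)) (toℕ i))))) ⟩
  + 1 * f zero + ∑[ j < _ ] (⟦ suc (toℕ j) ℕ.<? suc (toℕ i) ⟧ * f (suc j)) + f (suc i) ∎
  where open ≡-Reasoning

∑⟦<i⟧≡i : ∀ {n} (i : Fin n) → ∑[ j < n ] ⟦ toℕ j ℕ.<? toℕ i ⟧ ≡ + toℕ i
∑⟦<i⟧≡i {suc n} zero    = sum-replicate-zero (suc n)
∑⟦<i⟧≡i {suc n} (suc i) = cong (_+_ (+ 1)) (begin
  ∑[ j < n ] ⟦ suc (toℕ j) ℕ.<? suc (toℕ i) ⟧ ≡⟨ sum-cong-≗ {n} (λ j → ⟦1+m≤1+n⟧≡⟦m≤n⟧ (suc (toℕ j)) (toℕ i)) ⟩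
  ∑[ j < n ] ⟦ toℕ j ℕ.<? toℕ i ⟧             ≡⟨ ∑⟦<i⟧≡i i ⟩
  + toℕ i                                     ∎)
  where open ≡-Reasoning

[r+q*d]/ℕd≡q : ∀ q {r} d .{{_ : ℕ.NonZero d}} → r ℕ.< d → (+ r + q * + d) /ℕ d ≡ q
[r+q*d]/ℕd≡q q {r} d r<d = ℤP.≤-antisym
  (below-suc (a /ℕ d) q ([n/ℕd]*d≤n a d) a<[q+1]d)
  (below-suc q (a /ℕ d) (ℤP.i≤j+i (q * + d) (+ r)) (n<s[n/ℕd]*d a d))
  where
  a : ℤ
  a = + r + q * + d
  a<[q+1]d : a < sucℤ q * + d
  a<[q+1]d = subst (a <_) (sym (ℤP.suc-* q (+ d))) (ℤP.+-monoˡ-< (q * + d) (+<+ r<d))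
  below-suc : ∀ x y → x * + d ≤ a → a < sucℤ y * + d → x ≤ y
  below-suc x y xd≤a a<[y+1]d = subst (x ≤_) (ℤP.pred-suc y)
    (ℤP.i<j⇒i≤pred[j] (ℤP.*-cancelʳ-<-nonNeg {x} {sucℤ y} (+ d) (ℤP.≤-<-trans xd≤a a<[y+1]d)))

[q*d+x]/ℕd≡q-⟦x<0⟧ : ∀ q x d .{{_ : ℕ.NonZero d}} → ∣ x ∣ ℕ.< d → (q * + d + x) /ℕ d ≡ q - ⟦ x <? + 0 ⟧
[q*d+x]/ℕd≡q-⟦x<0⟧ q (+ m) d m<d = begin
  (q * + d + + m) /ℕ d ≡⟨ cong (_/ℕ d) (ℤP.+-comm (q * + d) (+ m)) ⟩
  (+ m + q * + d) /ℕ d ≡⟨ [r+q*d]/ℕd≡q q d m<d ⟩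
  q                    ≡⟨ sym (ℤP.+-identityʳ q) ⟩
  q - + 0              ∎
  where open ≡-Reasoning
[q*d+x]/ℕd≡q-⟦x<0⟧ q -[1+ m ] d m<d = begin
  (q * + d - + suc m) /ℕ d                  ≡⟨ cong (_/ℕ d) (borrow q (+ d) (+ suc m)) ⟩
  ((+ d - + suc m) + (q - + 1) * + d) /ℕ d  ≡⟨ cong (λ r → (r + (q - + 1) * + d) /ℕ d) d-[1+m]≡d∸[1+m] ⟩
  (+ (d ℕ.∸ suc m) + (q - + 1) * + d) /ℕ d  ≡⟨ [r+q*d]/ℕd≡q (q - + 1) d (ℕP.∸-monoʳ-< {o = 0} (ℕ.s≤s ℕ.z≤n) (ℕP.<⇒≤ m<d)) ⟩
  q - + 1                                   ∎
  where
  open ≡-Reasoning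
  borrow : ∀ q d s → q * d - s ≡ (d - s) + (q - + 1) * d
  borrow = solve-∀
  d-[1+m]≡d∸[1+m] : + d - + suc m ≡ + (d ℕ.∸ suc m)
  d-[1+m]≡d∸[1+m] = trans (ℤP.m-n≡m⊖n d (suc m)) (ℤP.⊖-≥ (ℕP.<⇒≤ m<d))

∣σ∣≤n : ∀ {n} (σ : Fin n → ℤ) → IsSignedPerm n σ → ∀ i → ∣ σ i ∣ ℕ.≤ n
∣σ∣≤n σ perm i with ∈-map⁻ suc (∈-resp-↭ perm (∈-tabulate⁺ {f = λ i → ∣ σ i ∣} i))
... | k , k∈upTo , ∣σi∣≡1+k rewrite ∣σi∣≡1+k = ∈-upTo⁻ k∈upTo

x,y≤n⇒x+y<Nℕn : ∀ {n x y} → x ℕ.≤ n → y ℕ.≤ n → x ℕ.+ y ℕ.< Nℕ n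
x,y≤n⇒x+y<Nℕn {n} x≤n y≤n = ℕ.s≤s (ℕP.m≤n⇒m≤1+n
  (ℕP.≤-trans (ℕP.+-mono-≤ x≤n y≤n) (ℕP.≤-reflexive (cong (n ℕ.+_) (sym (ℕP.+-identityʳ n))))))

i-j<0⇔i<j : ∀ i j → (i - j < + 0) ⇔ (i < j)
i-j<0⇔i<j i j = mk⇔
  (λ i-j<0 → subst₂ _<_ (cancel i j) (ℤP.+-identityˡ j) (ℤP.+-monoˡ-< j i-j<0))
  (λ i<j → subst (i - j <_) (ℤP.+-inverseʳ j) (ℤP.+-monoˡ-< (- j) i<j))
  where
  cancel : ∀ i j → (i - j) + j ≡ i
  cancel = solve-∀

i+i<0⇔i<0 : ∀ i → (i + i < + 0) ⇔ (i < + 0)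
i+i<0⇔i<0 (+ m)    = mk⇔ (λ { (+<+ ()) }) (λ { (+<+ ()) })
i+i<0⇔i<0 -[1+ m ] = mk⇔ (λ _ → -<+) (λ _ → -<+)

invRow : ∀ {n} → (Fin n → ℤ) → Fin n → ℤ
invRow {n} σ i = ∑[ j < n ] (⟦ toℕ j ℕ.<? toℕ i ⟧ * ⟦ σ i <? σ j ⟧)

nspRow : ∀ {n} → (Fin n → ℤ) → Fin n → ℤ
nspRow {n} σ i = ∑[ j < n ] (⟦ toℕ j ℕ.<? toℕ i ⟧ * ⟦ σ i + σ j <? + 0 ⟧)

invCRow : ∀ {n} → (Fin n → ℤ) → Fin n → ℤ
invCRow σ i = invRow σ i + ⟦ σ i <? + 0 ⟧ + nspRow σ i

∑-invRow≡inv : ∀ {n} (σ : Fin n → ℤ) → ∑[ i < n ] invRow σ i ≡ + invC0 σ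
∑-invRow≡inv σ = sym (trans (length-filter-pairsLt (λ p → σ (proj₂ p) <? σ (proj₁ p)))
  (∑-comm (λ j i → ⟦ toℕ j ℕ.<? toℕ i ⟧ * ⟦ σ i <? σ j ⟧)))

∑-nspRow≡nsp : ∀ {n} (σ : Fin n → ℤ) → ∑[ i < n ] nspRow σ i ≡ + nsp σ
∑-nspRow≡nsp {n} σ = sym (begin
  + nsp σ
    ≡⟨ length-filter-pairsLt (λ p → σ (proj₁ p) + σ (proj₂ p) <? + 0) ⟩
  ∑[ j < n ] ∑[ i < n ] (⟦ toℕ j ℕ.<? toℕ i ⟧ * ⟦ σ j + σ i <? + 0 ⟧)
    ≡⟨ ∑-comm (λ j i → ⟦ toℕ j ℕ.<? toℕ i ⟧ * ⟦ σ j + σ i <? + 0 ⟧) ⟩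
  ∑[ i < n ] ∑[ j < n ] (⟦ toℕ j ℕ.<? toℕ i ⟧ * ⟦ σ j + σ i <? + 0 ⟧)
    ≡⟨ sum-cong-≗ (λ i → sum-cong-≗ (λ j → cong (λ x → ⟦ toℕ j ℕ.<? toℕ i ⟧ * ⟦ x <? + 0 ⟧) (ℤP.+-comm (σ j) (σ i)))) ⟩
  ∑[ i < n ] nspRow σ i ∎)
  where open ≡-Reasoning

∑⟦σi<0⟧≡neg : ∀ {n} (σ : Fin n → ℤ) → ∑[ i < n ] ⟦ σ i <? + 0 ⟧ ≡ + neg σ
∑⟦σi<0⟧≡neg {n} σ =
  sym (trans (length-filter≡listSum (λ i → σ i <? + 0) (allFin n)) (listSum-allFin (λ i → ⟦ σ i <? + 0 ⟧)))

∑-invCRow≡invC : ∀ {n} (σ : Fin n → ℤ) → ∑[ i < n ] invCRow σ i ≡ + invC σ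
∑-invCRow≡invC {n} σ = begin
  ∑[ i < n ] invCRow σ i
    ≡⟨ ∑-distrib-+ (λ i → invRow σ i + ⟦ σ i <? + 0 ⟧) (nspRow σ) ⟩
  ∑[ i < n ] (invRow σ i + ⟦ σ i <? + 0 ⟧) + ∑[ i < n ] nspRow σ i
    ≡⟨ cong (λ x → x + ∑[ i < n ] nspRow σ i) (∑-distrib-+ (invRow σ) (λ i → ⟦ σ i <? + 0 ⟧)) ⟩
  ∑[ i < n ] invRow σ i + ∑[ i < n ] ⟦ σ i <? + 0 ⟧ + ∑[ i < n ] nspRow σ i
    ≡⟨ cong₂ _+_ (cong₂ _+_ (∑-invRow≡inv σ) (∑⟦σi<0⟧≡neg σ)) (∑-nspRow≡nsp σ) ⟩
  + invC0 σ + + neg σ + + nsp σ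
    ≡⟨ sym (trans (ℤP.pos-+ (invC0 σ ℕ.+ neg σ) (nsp σ)) (cong (λ x → x + + nsp σ) (ℤP.pos-+ (invC0 σ) (neg σ)))) ⟩
  + invC σ ∎
  where open ≡-Reasoning

Ii≡∑⟦<i⟧*Iij+Iii : ∀ {n} (w : Fin n → ℤ) i →
  Ii w i ≡ ∑[ j < n ] (⟦ toℕ j ℕ.<? toℕ i ⟧ * Iij w i j) + Iij w i i
Ii≡∑⟦<i⟧*Iij+Iii {n} w i = begin
  Ii w i                                                   ≡⟨ listSum-map-filter (λ j → toℕ j ℕ.≤? toℕ i) (Iij w i) (allFin n) ⟩
  listSum (map (λ j → ⟦ toℕ j ℕ.≤? toℕ i ⟧ * Iij w i j) (allFin n)) ≡⟨ listSum-allFin (λ j → ⟦ toℕ j ℕ.≤? toℕ i ⟧ * Iij w i j) ⟩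
  ∑[ j < n ] (⟦ toℕ j ℕ.≤? toℕ i ⟧ * Iij w i j)            ≡⟨ ∑⟦≤i⟧*f≡∑⟦<i⟧*f+f[i] (Iij w i) i ⟩
  ∑[ j < n ] (⟦ toℕ j ℕ.<? toℕ i ⟧ * Iij w i j) + Iij w i i ∎
  where open ≡-Reasoning

module _ {n} (w c σ : Fin n → ℤ) (perm : IsSignedPerm n σ) (w≡cN+σ : ∀ i → w i ≡ c i * + Nℕ n + σ i) where

  private
    N : ℤ
    N = + Nℕ n

  ⌊[wi-wj]/N⌋ : ∀ i j → (w i - w j) /ℕ Nℕ n ≡ c i - c j - ⟦ σ i <? σ j ⟧
  ⌊[wi-wj]/N⌋ i j = begin
    (w i - w j) /ℕ Nℕ n                                   ≡⟨ cong (_/ℕ Nℕ n) (trans (cong₂ _-_ (w≡cN+σ i) (w≡cN+σ j)) (regroup (c i) (c j) (σ i) (σ j) N)) ⟩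
    ((c i - c j) * N + (σ i - σ j)) /ℕ Nℕ n               ≡⟨ [q*d+x]/ℕd≡q-⟦x<0⟧ (c i - c j) (σ i - σ j) (Nℕ n) ∣σi-σj∣<N ⟩
    c i - c j - ⟦ σ i - σ j <? + 0 ⟧                      ≡⟨ cong (_-_ (c i - c j)) (⟦⟧-⇔ (i-j<0⇔i<j (σ i) (σ j)) (σ i - σ j <? + 0) (σ i <? σ j)) ⟩
    c i - c j - ⟦ σ i <? σ j ⟧                            ∎
    where
    open ≡-Reasoning
    regroup : ∀ a b s t N → (a * N + s) - (b * N + t) ≡ (a - b) * N + (s - t)
    regroup = solve-∀
    ∣σi-σj∣<N : ∣ σ i - σ j ∣ ℕ.< Nℕ n
    ∣σi-σj∣<N = ℕP.≤-<-trans (ℤP.∣i-j∣≤∣i∣+∣j∣ (σ i) (σ j)) (x,y≤n⇒x+y<Nℕn (∣σ∣≤n σ perm i) (∣σ∣≤n σ perm j))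

  ⌊[wi+wj]/N⌋ : ∀ i j → (w i + w j) /ℕ Nℕ n ≡ c i + c j - ⟦ σ i + σ j <? + 0 ⟧
  ⌊[wi+wj]/N⌋ i j = begin
    (w i + w j) /ℕ Nℕ n                                   ≡⟨ cong (_/ℕ Nℕ n) (trans (cong₂ _+_ (w≡cN+σ i) (w≡cN+σ j)) (regroup (c i) (c j) (σ i) (σ j) N)) ⟩
    ((c i + c j) * N + (σ i + σ j)) /ℕ Nℕ n               ≡⟨ [q*d+x]/ℕd≡q-⟦x<0⟧ (c i + c j) (σ i + σ j) (Nℕ n) ∣σi+σj∣<N ⟩
    c i + c j - ⟦ σ i + σ j <? + 0 ⟧                      ∎
    where
    open ≡-Reasoning
    regroup : ∀ a b s t N → (a * N + s) + (b * N + t) ≡ (a + b) * N + (s + t)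
    regroup = solve-∀
    ∣σi+σj∣<N : ∣ σ i + σ j ∣ ℕ.< Nℕ n
    ∣σi+σj∣<N = ℕP.≤-<-trans (ℤP.∣i+j∣≤∣i∣+∣j∣ (σ i) (σ j)) (x,y≤n⇒x+y<Nℕn (∣σ∣≤n σ perm i) (∣σ∣≤n σ perm j))

  Iij+⟦σi<σj⟧+⟦σi+σj<0⟧≡2ci : ∀ i j → Iij w i j + ⟦ σ i <? σ j ⟧ + ⟦ σ i + σ j <? + 0 ⟧ ≡ + 2 * c i
  Iij+⟦σi<σj⟧+⟦σi+σj<0⟧≡2ci i j = begin
    Iij w i j + A + B                                     ≡⟨ cong (λ t → t + A + B) (cong₂ _+_ (⌊[wi-wj]/N⌋ i j) (⌊[wi+wj]/N⌋ i j)) ⟩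
    (c i - c j - A) + (c i + c j - B) + A + B             ≡⟨ cancel (c i) (c j) A B ⟩
    + 2 * c i                                             ∎
    where
    open ≡-Reasoning
    A = ⟦ σ i <? σ j ⟧
    B = ⟦ σ i + σ j <? + 0 ⟧
    cancel : ∀ x y a b → (x - y - a) + (x + y - b) + a + b ≡ + 2 * x
    cancel = solve-∀

  Ii+invCRow≡2[1+i]ci : ∀ i → Ii w i + invCRow σ i ≡ + (2 ℕ.* suc (toℕ i)) * c i
  Ii+invCRow≡2[1+i]ci i = begin
    Ii w i + invCRow σ i
      ≡⟨ cong (λ x → x + invCRow σ i) (Ii≡∑⟦<i⟧*Iij+Iii w i) ⟩
    ∑[ j < n ] (L j * Iij w i j) + Iij w i i + (invRow σ i + R + nspRow σ i)
      ≡⟨ regroup (∑[ j < n ] (L j * Iij w i j)) (Iij w i i) (invRow σ i) R (nspRow σ i) ⟩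
    ∑[ j < n ] (L j * Iij w i j) + invRow σ i + nspRow σ i + (Iij w i i + R)
      ≡⟨ cong₂ _+_ off-diagonal diagonal ⟩
    + toℕ i * (+ 2 * c i) + + 2 * c i
      ≡⟨ collect (+ toℕ i) (c i) ⟩
    (+ 2 * + suc (toℕ i)) * c i
      ≡⟨ cong (_* c i) (sym (ℤP.pos-* 2 (suc (toℕ i)))) ⟩
    + (2 ℕ.* suc (toℕ i)) * c i ∎
    where
    open ≡-Reasoning
    L : Fin n → ℤ
    L j = ⟦ toℕ j ℕ.<? toℕ i ⟧
    R : ℤ
    R = ⟦ σ i <? + 0 ⟧
    regroup : ∀ x d u r v → x + d + (u + r + v) ≡ x + u + v + (d + r)
    regroup = solve-∀
    collect : ∀ k x → k * (+ 2 * x) + + 2 * x ≡ (+ 2 * (+ 1 + k)) * x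
    collect = solve-∀
    factor : ∀ l x a b → l * x + l * a + l * b ≡ l * (x + a + b)
    factor = solve-∀
    off-diagonal : ∑[ j < n ] (L j * Iij w i j) + invRow σ i + nspRow σ i ≡ + toℕ i * (+ 2 * c i)
    off-diagonal = begin
      ∑[ j < n ] (L j * Iij w i j) + invRow σ i + nspRow σ i
        ≡⟨ cong (λ x → x + nspRow σ i) (sym (∑-distrib-+ (λ j → L j * Iij w i j) (λ j → L j * ⟦ σ i <? σ j ⟧))) ⟩
      ∑[ j < n ] (L j * Iij w i j + L j * ⟦ σ i <? σ j ⟧) + nspRow σ i
        ≡⟨ sym (∑-distrib-+ (λ j → L j * Iij w i j + L j * ⟦ σ i <? σ j ⟧) (λ j → L j * ⟦ σ i + σ j <? + 0 ⟧)) ⟩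
      ∑[ j < n ] (L j * Iij w i j + L j * ⟦ σ i <? σ j ⟧ + L j * ⟦ σ i + σ j <? + 0 ⟧)
        ≡⟨ sum-cong-≗ (λ j → trans (factor (L j) (Iij w i j) _ _) (cong (L j *_) (Iij+⟦σi<σj⟧+⟦σi+σj<0⟧≡2ci i j))) ⟩
      ∑[ j < n ] (L j * (+ 2 * c i))
        ≡⟨ sym (*-distribʳ-sum (+ 2 * c i) L) ⟩
      ∑[ j < n ] L j * (+ 2 * c i)
        ≡⟨ cong (_* (+ 2 * c i)) (∑⟦<i⟧≡i i) ⟩
      + toℕ i * (+ 2 * c i) ∎
    diagonal : Iij w i i + R ≡ + 2 * c i
    diagonal = begin
      Iij w i i + R                                   ≡⟨ cong (λ x → x + R) (sym (ℤP.+-identityʳ (Iij w i i))) ⟩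
      Iij w i i + + 0 + R                             ≡⟨ cong₂ (λ x y → Iij w i i + x + y)
                                                          (sym (⟦⟧-false (σ i <? σ i) (ℤP.<-irrefl refl)))
                                                          (sym (⟦⟧-⇔ (i+i<0⇔i<0 (σ i)) (σ i + σ i <? + 0) (σ i <? + 0))) ⟩
      Iij w i i + ⟦ σ i <? σ i ⟧ + ⟦ σ i + σ i <? + 0 ⟧ ≡⟨ Iij+⟦σi<σj⟧+⟦σi+σj<0⟧≡2ci i i ⟩
      + 2 * c i                                       ∎

mainTheorem13 : (n : ℕ) (w c σ : Fin n → ℤ) →
    IsAffineCosetWindow n w →
    IsSignedPerm n σ →
    (∀ i → w i ≡ c i * + (Nℕ n) + σ i) →
    invAffC w ≡ Σℤ (λ i → + (2 Data.Nat.* suc (toℕ i)) * c i) - + (invC σ)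
mainTheorem13 n w c σ _ perm w≡cN+σ = begin
  invAffC w                                               ≡⟨ Σℤ≡∑ (Ii w) ⟩
  ∑[ i < n ] Ii w i                                       ≡⟨ add-sub (∑[ i < n ] Ii w i) (∑[ i < n ] invCRow σ i) ⟩
  ∑[ i < n ] Ii w i + ∑[ i < n ] invCRow σ i - ∑[ i < n ] invCRow σ i
    ≡⟨ cong₂ _-_ (trans (sym (∑-distrib-+ (Ii w) (invCRow σ))) (sum-cong-≗ row)) (∑-invCRow≡invC σ) ⟩
  ∑[ i < n ] D i - + invC σ                               ≡⟨ cong (_- + invC σ) (sym (Σℤ≡∑ D)) ⟩
  Σℤ D - + invC σ                                         ∎
  where
  open ≡-Reasoning
  D : Fin n → ℤ
  D i = + (2 ℕ.* suc (toℕ i)) * c i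
  row : ∀ i → Ii w i + invCRow σ i ≡ D i
  row = Ii+invCRow≡2[1+i]ci w c σ perm w≡cN+σ
  add-sub : ∀ x y → x ≡ x + y - y
  add-sub = solve-∀
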